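{- Let $G=G(V,E)$ be any simple graph on $n$ vertices with chromatic number $k=\chi(G)$. Then $\varepsilon(G)\geq\dfrac{n!}{k^{n-k}\,k!}$.
   Context: For a simple graph $G$, $\varepsilon(G)$ denotes the maximum, over all acyclic orientations of $E$, of the number of linear extensions of the partial order on $V$ induced by the orientation ($u<v$ iff there is a directed path from $u$ to $v$; a linear extension is a bijection $f:V\to[n]$ with $f(u)<f(v)$ whenever $u<v$). -}

module Defs where

open import Data.Nat using (ℕ; _≤_)
open import Data.Fin using (Fin) renaming (_<_ to _<ᶠ_)
open import Data.Bool using (Bool; true; false)
open import Data.Product using (Σ; ∃; _×_)
open import Data.Sum using (_⊎_)
open import Data.List using (List; length)
open import Data.List.Relation.Unary.AllPairs using (AllPairs)
open import Data.List.Relation.Unary.All using (All)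
open import Relation.Binary.PropositionalEquality using (_≡_; _≢_)
open import Relation.Binary.Construct.Closure.Transitive using (TransClosure)
open import Relation.Nullary using (¬_)
open import Function.Definitions using (Bijective)

record SimpleGraph (n : ℕ) : Set where
  field
    adj     : Fin n → Fin n → Bool
    sym     : ∀ u v → adj u v ≡ adj v u
    irrefl  : ∀ v → adj v v ≡ false
open SimpleGraph public

ProperColouring : ∀ {n} → SimpleGraph n → (k : ℕ) → (Fin n → Fin k) → Set
ProperColouring G k c = ∀ u v → adj G u v ≡ true → c u ≢ c v

Colourable : ∀ {n} → SimpleGraph n → ℕ → Set
Colourable {n} G k = Σ (Fin n → Fin k) (ProperColouring G k)

IsChromaticNumber : ∀ {n} → SimpleGraph n → ℕ → Set
IsChromaticNumber G k = Colourable G k × (∀ m → Colourable G m → k ≤ m)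

-- An orientation of the edges: O u v = true means edge uv is directed u → v.
IsOrientation : ∀ {n} → SimpleGraph n → (Fin n → Fin n → Bool) → Set
IsOrientation {n} G O =
  (∀ (u v : Fin n) → O u v ≡ true → adj G u v ≡ true) ×
  (∀ (u v : Fin n) → adj G u v ≡ true → O u v ≡ true ⊎ O v u ≡ true) ×
  (∀ (u v : Fin n) → O u v ≡ true → O v u ≡ false)

-- Strict order induced by O: u < v iff there is a (nonempty) directed path u → v.
Reach : ∀ {n} → (Fin n → Fin n → Bool) → Fin n → Fin n → Set
Reach O = TransClosure (λ u v → O u v ≡ true)

IsAcyclic : ∀ {n} → (Fin n → Fin n → Bool) → Set
IsAcyclic {n} O = ∀ (v : Fin n) → ¬ Reach O v v

IsAcyclicOrientation : ∀ {n} → SimpleGraph n → (Fin n → Fin n → Bool) → Set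
IsAcyclicOrientation G O = IsOrientation G O × IsAcyclic O

IsLinearExtension : ∀ {n} → (Fin n → Fin n → Bool) → (Fin n → Fin n) → Set
IsLinearExtension {n} O f = Bijective _≡_ _≡_ f × (∀ (u v : Fin n) → Reach O u v → f u <ᶠ f v)

-- O has at least m linear extensions: there is a list of pairwise distinct
-- linear extensions of length ≥ m.
AtLeastLinExts : ∀ {n} → (Fin n → Fin n → Bool) → ℕ → Set
AtLeastLinExts {n} O m =
  Σ (List (Fin n → Fin n)) λ fs →
    All (IsLinearExtension O) fs ×
    AtPairs fs ×
    m ≤ length fs
  where
  AtPairs : List (Fin n → Fin n) → Set
  AtPairs = AllPairs (λ f g → ∃ λ x → f x ≢ g x)

-- ε(G) ≥ m : some acyclic orientation has at least m linear extensions.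
EpsAtLeast : ∀ {n} → SimpleGraph n → ℕ → Set
EpsAtLeast {n} G m = Σ (Fin n → Fin n → Bool) λ O → IsAcyclicOrientation G O × AtLeastLinExts O m

module Submission where

-- Fix a proper colouring col with k = χ(G) colours.  By minimality every colour is
-- used, so the class sizes a₀, …, a_{k-1} are all ≥ 1 and sum to n.  Orient every
-- edge from the smaller colour to the larger one; colours strictly increase along
-- directed paths, so the orientation is acyclic, and every bijection sending the
-- vertices of colour i into the i-th block of consecutive positions
-- [a₀ + … + a_{i-1}, a₀ + … + a_i) is a linear extension.  There are Π aᵢ! such
-- "block bijections"; we list them explicitly by induction on n, inserting vertex 0
-- at any position of its block.  The theorem then follows from the arithmetic
-- inequality n! ≤ Π aᵢ! · k^(n-k) · k!, proved by induction on n by lowering a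
-- largest aⱼ (which satisfies n ≤ k · aⱼ).

open import Defs hiding (sym)
open import Data.Nat using (ℕ; _≤_; _*_; _^_; _∸_; _!)
open import Data.Product using (Σ; _×_)
open import Data.Nat using (zero; suc; pred; _+_; _<_; _≟_; _≤?_; _<?_; z≤n; s≤s; s≤s⁻¹; >-nonZero)
open import Data.Nat.Properties
open import Data.Nat.Tactic.RingSolver using (solve-∀)
open import Data.Fin using (Fin; zero; suc; toℕ; fromℕ<; punchIn; punchOut) renaming (_≟_ to _≟ᶠ_)
open import Data.Fin.Properties
  using (toℕ<n; toℕ≤pred[n]; toℕ-fromℕ<; toℕ-injective; punchIn-injective; punchInᵢ≢i;
         punchIn-punchOut; punchOut-injective; any?; ¬∀⟶∃¬)
open import Data.Bool using (Bool; true; false; _∧_)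
open import Data.Bool.Properties using (∧-zeroʳ; ∧-conicalˡ; ∧-conicalʳ)
open import Data.List using (List; []; _∷_; map; length; tabulate; cartesianProductWith)
open import Data.List.Properties using (length-++; length-map; length-tabulate)
open import Data.List.Relation.Unary.All as All using (All; []; _∷_)
import Data.List.Relation.Unary.All.Properties as All
open import Data.List.Relation.Unary.AllPairs as AllPairs using ([]; _∷_)
open import Data.List.Relation.Unary.Unique.Setoid using (Unique)
import Data.List.Relation.Unary.Unique.Setoid.Properties as Uniqueₛ
import Data.List.Relation.Unary.Unique.Propositional.Properties as Unique
open import Data.Product using (_,_; ∃; proj₁; proj₂)
open import Data.Sum using (_⊎_; inj₁; inj₂)
open import Function using (_∘_)
open import Function.Definitions using (Bijective)
import Function.Construct.Identity as Identity
open import Relation.Binary.Definitions using (tri<; tri≈; tri>)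
open import Relation.Binary.PropositionalEquality
  using (_≡_; _≢_; refl; sym; trans; cong; cong₂; subst; setoid; _→-setoid_; module ≡-Reasoning)
open import Relation.Binary.Construct.Closure.Transitive using ([_]; _∷_)
open import Relation.Nullary using (Dec; yes; no; does; contradiction)
open import Relation.Nullary.Decidable using (dec-true; dec-false)

-- Sums and products over an initial segment of indices

sumUpTo : ℕ → (ℕ → ℕ) → ℕ
sumUpTo zero    a = 0
sumUpTo (suc m) a = sumUpTo m a + a m

factProd : ℕ → (ℕ → ℕ) → ℕ
factProd zero    a = 1
factProd (suc m) a = factProd m a * a m !

sumUpTo-cong : ∀ m {a b : ℕ → ℕ} → (∀ i → a i ≡ b i) → sumUpTo m a ≡ sumUpTo m b
sumUpTo-cong zero    a≗b = refl
sumUpTo-cong (suc m) a≗b = cong₂ _+_ (sumUpTo-cong m a≗b) (a≗b m)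

factProd-cong : ∀ m {a b : ℕ → ℕ} → (∀ i → a i ≡ b i) → factProd m a ≡ factProd m b
factProd-cong zero    a≗b = refl
factProd-cong (suc m) a≗b = cong₂ (λ P x → P * x !) (factProd-cong m a≗b) (a≗b m)

sumUpTo-mono : ∀ a {m m′} → m ≤ m′ → sumUpTo m a ≤ sumUpTo m′ a
sumUpTo-mono a {m} {zero}   z≤n = ≤-refl
sumUpTo-mono a {m} {suc m′} m≤m′ with m ≟ suc m′
... | yes refl = ≤-refl
... | no  m≢m′ = ≤-trans (sumUpTo-mono a (s≤s⁻¹ (≤∧≢⇒< m≤m′ m≢m′))) (m≤m+n _ (a m′))

sumUpTo-zeroes : ∀ m → sumUpTo m (λ _ → 0) ≡ 0
sumUpTo-zeroes zero    = refl
sumUpTo-zeroes (suc m) = trans (+-identityʳ _) (sumUpTo-zeroes m)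

factProd-zeroes : ∀ m → factProd m (λ _ → 0) ≡ 1
factProd-zeroes zero    = refl
factProd-zeroes (suc m) = trans (*-identityʳ _) (factProd-zeroes m)

adjust : ℕ → (ℕ → ℕ) → (ℕ → ℕ) → ℕ → ℕ
adjust zero    g a zero    = g (a zero)
adjust zero    g a (suc i) = a (suc i)
adjust (suc j) g a zero    = a zero
adjust (suc j) g a (suc i) = adjust j g (a ∘ suc) i

adjust-here : ∀ j g a → adjust j g a j ≡ g (a j)
adjust-here zero    g a = refl
adjust-here (suc j) g a = adjust-here j g (a ∘ suc)

adjust-elsewhere : ∀ {j i} g a → j ≢ i → adjust j g a i ≡ a i
adjust-elsewhere {zero}  {zero}  g a j≢i = contradiction refl j≢i
adjust-elsewhere {zero}  {suc i} g a j≢i = refl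
adjust-elsewhere {suc j} {zero}  g a j≢i = refl
adjust-elsewhere {suc j} {suc i} g a j≢i = adjust-elsewhere g (a ∘ suc) (j≢i ∘ cong suc)

bump : ℕ → (ℕ → ℕ) → ℕ → ℕ
bump j = adjust j suc

lower : ℕ → (ℕ → ℕ) → ℕ → ℕ
lower j = adjust j pred

bump-≥ : ∀ j a i → a i ≤ bump j a i
bump-≥ j a i with j ≟ i
... | yes refl = ≤-trans (n≤1+n (a j)) (≤-reflexive (sym (adjust-here j suc a)))
... | no  j≢i  = ≤-reflexive (sym (adjust-elsewhere suc a j≢i))

sumUpTo-bump-below : ∀ {m j} a → m ≤ j → sumUpTo m (bump j a) ≡ sumUpTo m a
sumUpTo-bump-below {zero}  a _   = refl
sumUpTo-bump-below {suc m} a m<j =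
  cong₂ _+_ (sumUpTo-bump-below a (<⇒≤ m<j)) (adjust-elsewhere suc a (>⇒≢ m<j))

sumUpTo-bump-above : ∀ {m j} a → j < m → sumUpTo m (bump j a) ≡ suc (sumUpTo m a)
sumUpTo-bump-above {suc m} {j} a j<1+m with j ≟ m
... | yes refl = begin
  sumUpTo j (bump j a) + bump j a j  ≡⟨ cong₂ _+_ (sumUpTo-bump-below {j} {j} a ≤-refl) (adjust-here j suc a) ⟩
  sumUpTo j a + suc (a j)            ≡⟨ +-suc (sumUpTo j a) (a j) ⟩
  suc (sumUpTo j a + a j)            ∎
  where open ≡-Reasoning
... | no  j≢m  = cong₂ _+_ (sumUpTo-bump-above a (≤∧≢⇒< (s≤s⁻¹ j<1+m) j≢m)) (adjust-elsewhere suc a j≢m)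

factProd-bump-below : ∀ {m j} a → m ≤ j → factProd m (bump j a) ≡ factProd m a
factProd-bump-below {zero}  a _   = refl
factProd-bump-below {suc m} a m<j =
  cong₂ (λ P x → P * x !) (factProd-bump-below a (<⇒≤ m<j)) (adjust-elsewhere suc a (>⇒≢ m<j))

factProd-bump-above : ∀ {m j} a → j < m → factProd m (bump j a) ≡ suc (a j) * factProd m a
factProd-bump-above {suc m} {j} a j<1+m with j ≟ m
... | yes refl = begin
  factProd j (bump j a) * bump j a j !  ≡⟨ cong₂ (λ P x → P * x !) (factProd-bump-below {j} {j} a ≤-refl) (adjust-here j suc a) ⟩
  factProd j a * (suc (a j) * a j !)    ≡⟨ swap (factProd j a) (suc (a j)) (a j !) ⟩
  suc (a j) * (factProd j a * a j !)    ∎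
  where
  open ≡-Reasoning
  swap : ∀ x y z → x * (y * z) ≡ y * (x * z)
  swap = solve-∀
... | no  j≢m  = trans
  (cong₂ (λ P x → P * x !) (factProd-bump-above a (≤∧≢⇒< (s≤s⁻¹ j<1+m) j≢m)) (adjust-elsewhere suc a j≢m))
  (*-assoc (suc (a j)) (factProd m a) (a m !))

-- The arithmetic inequality  n! ≤ Π_{i<k} aᵢ! · k^(n-k) · k!

AllPositive : ℕ → (ℕ → ℕ) → Set
AllPositive k a = ∀ i → i < k → 1 ≤ a i

sumUpTo-positive : ∀ k {a} → AllPositive k a → k ≤ sumUpTo k a
sumUpTo-positive zero    _   = z≤n
sumUpTo-positive (suc k) pos = ≤-trans (≤-reflexive (+-comm 1 k))
  (+-mono-≤ (sumUpTo-positive k (λ i i<k → pos i (m<n⇒m<1+n i<k))) (pos k ≤-refl))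

averaging : ∀ k a → Σ ℕ λ j → j < suc k × sumUpTo (suc k) a ≤ suc k * a j
averaging zero    a = 0 , s≤s z≤n , m≤m+n (a 0) 0
averaging (suc k) a with averaging k a
... | j , j<1+k , bound with a (suc k) ≤? a j
...   | yes last≤aj = j , m<n⇒m<1+n j<1+k ,
        ≤-trans (+-mono-≤ bound last≤aj) (≤-reflexive (+-comm (suc k * a j) (a j)))
...   | no  last≰aj = suc k , ≤-refl ,
        ≤-trans (+-mono-≤ (≤-trans bound (*-monoʳ-≤ (suc k) (<⇒≤ (≰⇒> last≰aj)))) ≤-refl)
                (≤-reflexive (+-comm (suc k * a (suc k)) (a (suc k))))

factorial-mono : ∀ {m n} → m ≤ n → m ! ≤ n !
factorial-mono {m} {zero}  z≤n = ≤-refl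
factorial-mono {m} {suc n} m≤1+n with m ≟ suc n
... | yes refl = ≤-refl
... | no  m≢1+n = ≤-trans (factorial-mono (s≤s⁻¹ (≤∧≢⇒< m≤1+n m≢1+n))) (m≤n*m (n !) (suc n))

factProd-positive : ∀ m a → 1 ≤ factProd m a
factProd-positive zero    a = ≤-refl
factProd-positive (suc m) a = *-mono-≤ (factProd-positive m a) (1≤n! (a m))

-- Base case n ≤ k: then k^(n-k) = 1 and n! ≤ k!.
factorial-bound-small : ∀ {n k} P → 1 ≤ P → n ≤ k → n ! ≤ P * (k ^ (n ∸ k) * k !)
factorial-bound-small {n} {k} P 1≤P n≤k = begin
  n !                        ≤⟨ factorial-mono n≤k ⟩
  k !                        ≡⟨ sym (*-identityˡ (k !)) ⟩
  k ^ 0 * k !                ≡⟨ cong (λ e → k ^ e * k !) (sym (m≤n⇒m∸n≡0 n≤k)) ⟩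
  k ^ (n ∸ k) * k !          ≡⟨ sym (*-identityˡ _) ⟩
  1 * (k ^ (n ∸ k) * k !)    ≤⟨ *-monoˡ-≤ _ 1≤P ⟩
  P * (k ^ (n ∸ k) * k !)    ∎
  where open ≤-Reasoning

-- Inductive step: (m+1)! = (m+1) · m!, and m + 1 ≤ k · A trades the new factor
-- m + 1 for one more power of k and the factor A.
factorial-bound-step : ∀ {m k A P} → k ≤ m → suc m ≤ k * A →
  m ! ≤ P * (k ^ (m ∸ k) * k !) → suc m ! ≤ (A * P) * (k ^ (suc m ∸ k) * k !)
factorial-bound-step {m} {k} {A} {P} k≤m 1+m≤kA ih = begin
  suc m * m !                           ≤⟨ *-mono-≤ 1+m≤kA ih ⟩
  (k * A) * (P * (k ^ (m ∸ k) * k !))   ≡⟨ regroup k A P (k ^ (m ∸ k)) (k !) ⟩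
  (A * P) * (k ^ suc (m ∸ k) * k !)     ≡⟨ cong (λ e → (A * P) * (k ^ e * k !)) (sym (+-∸-assoc 1 k≤m)) ⟩
  (A * P) * (k ^ (suc m ∸ k) * k !)     ∎
  where
  open ≤-Reasoning
  regroup : ∀ k A P Y X → (k * A) * (P * (Y * X)) ≡ (A * P) * ((k * Y) * X)
  regroup = solve-∀

bump-lower : ∀ j a → 1 ≤ a j → ∀ i → bump j (lower j a) i ≡ a i
bump-lower j a 1≤aj i with j ≟ i
... | yes refl = trans (adjust-here j suc (lower j a))
                       (trans (cong suc (adjust-here j pred a)) (suc-pred (a j) {{>-nonZero 1≤aj}}))
... | no  j≢i  = trans (adjust-elsewhere suc (lower j a) j≢i) (adjust-elsewhere pred a j≢i)

lower-positive : ∀ {k} j a → 2 ≤ a j → AllPositive k a → AllPositive k (lower j a)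
lower-positive j a 2≤aj pos i i<k with j ≟ i
... | yes refl = subst (1 ≤_) (sym (adjust-here j pred a)) (pred-mono-≤ 2≤aj)
... | no  j≢i  = subst (1 ≤_) (sym (adjust-elsewhere pred a j≢i)) (pos i i<k)

factorial-bound : ∀ n k a → AllPositive k a → sumUpTo k a ≡ n →
                  n ! ≤ factProd k a * (k ^ (n ∸ k) * k !)
factorial-bound zero    k       a _   _  = factorial-bound-small {zero} {k} (factProd k a) (factProd-positive k a) z≤n
factorial-bound (suc m) zero    a _   ()
factorial-bound (suc m) (suc k) a pos total with suc m ≤? suc k
... | yes n≤k = factorial-bound-small (factProd (suc k) a) (factProd-positive (suc k) a) n≤k
... | no  n≰k with averaging k a
...   | j , j<k , average =
  subst (λ P → suc m ! ≤ P * (suc k ^ (suc m ∸ suc k) * suc k !)) (sym prod-split)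
    (factorial-bound-step k≤m large (factorial-bound m (suc k) a′ pos′ sum-a′))
  where
  a′ : ℕ → ℕ
  a′ = lower j a
  large : suc m ≤ suc k * a j
  large = subst (_≤ suc k * a j) total average
  -- aⱼ ≤ 1 would force n ≤ k.
  2≤aj : 2 ≤ a j
  2≤aj = ≰⇒> λ aj≤1 →
    n≰k (≤-trans large (≤-trans (*-monoʳ-≤ (suc k) aj≤1) (≤-reflexive (*-identityʳ (suc k)))))
  a≗bump : ∀ i → a i ≡ bump j a′ i
  a≗bump i = sym (bump-lower j a (<⇒≤ 2≤aj) i)
  pos′ : AllPositive (suc k) a′
  pos′ = lower-positive j a 2≤aj pos
  sum-a′ : sumUpTo (suc k) a′ ≡ m
  sum-a′ = suc-injective (trans (sym (trans (sumUpTo-cong (suc k) a≗bump) (sumUpTo-bump-above a′ j<k))) total)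
  prod-split : factProd (suc k) a ≡ a j * factProd (suc k) a′
  prod-split = begin
    factProd (suc k) a              ≡⟨ factProd-cong (suc k) a≗bump ⟩
    factProd (suc k) (bump j a′)    ≡⟨ factProd-bump-above a′ j<k ⟩
    suc (a′ j) * factProd (suc k) a′ ≡⟨ cong (_* factProd (suc k) a′) (trans (sym (adjust-here j suc a′)) (sym (a≗bump j))) ⟩
    a j * factProd (suc k) a′       ∎
    where open ≡-Reasoning
  k≤m : suc k ≤ m
  k≤m = subst (suc k ≤_) sum-a′ (sumUpTo-positive (suc k) pos′)

-- Colour classes and block bijections

-- classSize col i = number of vertices v with col v ≡ i.
classSize : ∀ {n} → (Fin n → ℕ) → ℕ → ℕ
classSize {zero}  col = λ _ → 0
classSize {suc n} col = bump (col zero) (classSize (col ∘ suc))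

classSize-total : ∀ {n} K (col : Fin n → ℕ) → (∀ v → col v < K) → sumUpTo K (classSize col) ≡ n
classSize-total {zero}  K col _       = sumUpTo-zeroes K
classSize-total {suc n} K col bounded =
  trans (sumUpTo-bump-above _ (bounded zero)) (cong suc (classSize-total K (col ∘ suc) (bounded ∘ suc)))

classSize-occupied : ∀ {n} (col : Fin n → ℕ) v → 1 ≤ classSize col (col v)
classSize-occupied {suc n} col zero    = subst (1 ≤_) (sym (adjust-here (col zero) suc _)) (s≤s z≤n)
classSize-occupied {suc n} col (suc v) = ≤-trans (classSize-occupied (col ∘ suc) v) (bump-≥ (col zero) (classSize (col ∘ suc)) (col (suc v)))

blockStart : ∀ {n} → (Fin n → ℕ) → ℕ → ℕ
blockStart col i = sumUpTo i (classSize col)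

InBlock : ∀ {n} → (Fin n → ℕ) → (Fin n → Fin n) → Fin n → Set
InBlock col f v = blockStart col (col v) ≤ toℕ (f v) × toℕ (f v) < blockStart col (suc (col v))

BlockBijection : ∀ {n} → (Fin n → ℕ) → (Fin n → Fin n) → Set
BlockBijection col f = Bijective _≡_ _≡_ f × (∀ v → InBlock col f v)

blockStart-below : ∀ {n} (col : Fin (suc n) → ℕ) {i} → i ≤ col zero → blockStart col i ≡ blockStart (col ∘ suc) i
blockStart-below col = sumUpTo-bump-below (classSize (col ∘ suc))

blockStart-above : ∀ {n} (col : Fin (suc n) → ℕ) {i} → col zero < i → blockStart col i ≡ suc (blockStart (col ∘ suc) i)
blockStart-above col = sumUpTo-bump-above (classSize (col ∘ suc))

toℕ-punchIn-below : ∀ {n} (p : Fin (suc n)) x → toℕ x < toℕ p → toℕ (punchIn p x) ≡ toℕ x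
toℕ-punchIn-below (suc p) zero    _           = refl
toℕ-punchIn-below (suc p) (suc x) (s≤s x<p)   = cong suc (toℕ-punchIn-below p x x<p)

toℕ-punchIn-above : ∀ {n} (p : Fin (suc n)) x → toℕ p ≤ toℕ x → toℕ (punchIn p x) ≡ suc (toℕ x)
toℕ-punchIn-above zero    x       _         = refl
toℕ-punchIn-above (suc p) (suc x) (s≤s p≤x) = cong suc (toℕ-punchIn-above p x p≤x)

toℕ-punchIn-bounds : ∀ {n} (p : Fin (suc n)) x → toℕ x ≤ toℕ (punchIn p x) × toℕ (punchIn p x) ≤ suc (toℕ x)
toℕ-punchIn-bounds zero    x       = n≤1+n _ , ≤-refl
toℕ-punchIn-bounds (suc p) zero    = z≤n , z≤n
toℕ-punchIn-bounds (suc p) (suc x) with toℕ-punchIn-bounds p x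
... | lower-bound , upper-bound = s≤s lower-bound , s≤s upper-bound

extend : ∀ {n} → Fin (suc n) → (Fin n → Fin n) → Fin (suc n) → Fin (suc n)
extend p f zero    = p
extend p f (suc v) = punchIn p (f v)

extend-bijective : ∀ {n} (p : Fin (suc n)) f → Bijective _≡_ _≡_ f → Bijective _≡_ _≡_ (extend p f)
extend-bijective p f (f-injective , f-surjective) = injective , surjective
  where
  injective : ∀ {x y} → extend p f x ≡ extend p f y → x ≡ y
  injective {zero}  {zero}  _ = refl
  injective {zero}  {suc y} e = contradiction (sym e) (punchInᵢ≢i p (f y))
  injective {suc x} {zero}  e = contradiction e (punchInᵢ≢i p (f x))
  injective {suc x} {suc y} e = cong suc (f-injective (punchIn-injective p _ _ e))
  surjective : ∀ y → ∃ λ x → ∀ {z} → z ≡ x → extend p f z ≡ y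
  surjective y with p ≟ᶠ y
  ... | yes p≡y = zero , λ { refl → p≡y }
  ... | no  p≢y with f-surjective (punchOut p≢y)
  ...   | x , fx≡ = suc x , λ { refl → trans (cong (punchIn p) (fx≡ refl)) (punchIn-punchOut p≢y) }

extend-injective : ∀ {n} {p q : Fin (suc n)} {f g} → (∀ x → extend p f x ≡ extend q g x) →
                   p ≡ q × (∀ x → f x ≡ g x)
extend-injective {p = p} {f = f} {g} same = p≡q , λ x →
  punchIn-injective p (f x) (g x) (trans (same (suc x)) (cong (λ r → punchIn r (g x)) (sym p≡q)))
  where
  p≡q = same zero

extend-inBlock : ∀ {n} (col : Fin (suc n) → ℕ) (p : Fin (suc n)) (f : Fin n → Fin n) →
  blockStart (col ∘ suc) (col zero) ≤ toℕ p → toℕ p ≤ blockStart (col ∘ suc) (suc (col zero)) →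
  (∀ v → InBlock (col ∘ suc) f v) → ∀ v → InBlock col (extend p f) v
extend-inBlock col p f lo≤p p≤hi inBlock zero =
  ≤-trans (≤-reflexive (blockStart-below col ≤-refl)) lo≤p ,
  ≤-trans (s≤s p≤hi) (≤-reflexive (sym (blockStart-above col ≤-refl)))
extend-inBlock col p f lo≤p p≤hi inBlock (suc w) with inBlock w | <-cmp (col (suc w)) (col zero)
-- A smaller colour: f w lies before p, so neither it nor its block moves.
... | l , u | tri< i<j _ _ =
  ≤-trans (≤-reflexive (blockStart-below col (<⇒≤ i<j))) (≤-trans l (≤-reflexive (sym unmoved))) ,
  ≤-trans (s≤s (≤-reflexive unmoved)) (≤-trans u (≤-reflexive (sym (blockStart-below col i<j))))
  where
  unmoved : toℕ (punchIn p (f w)) ≡ toℕ (f w)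
  unmoved = toℕ-punchIn-below p (f w) (<-≤-trans u (≤-trans (sumUpTo-mono _ i<j) lo≤p))
-- The colour of vertex 0: f w moves by at most one and the block grows by one.
... | l , u | tri≈ _ i≡j _ =
  ≤-trans (≤-reflexive (blockStart-below col (≤-reflexive i≡j))) (≤-trans l (proj₁ bounds)) ,
  ≤-trans (s≤s (proj₂ bounds)) (≤-trans (s≤s u) (≤-reflexive (sym (blockStart-above col (s≤s (≤-reflexive (sym i≡j)))))))
  where
  bounds : toℕ (f w) ≤ toℕ (punchIn p (f w)) × toℕ (punchIn p (f w)) ≤ suc (toℕ (f w))
  bounds = toℕ-punchIn-bounds p (f w)
-- A larger colour: f w lies at or after p, so it and its block move up by one.
... | l , u | tri> _ _ j<i =
  ≤-trans (≤-reflexive (blockStart-above col j<i)) (≤-trans (s≤s l) (≤-reflexive (sym shifted))) ,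
  ≤-trans (s≤s (≤-reflexive shifted)) (≤-trans (s≤s u) (≤-reflexive (sym (blockStart-above col (m<n⇒m<1+n j<i)))))
  where
  shifted : toℕ (punchIn p (f w)) ≡ suc (toℕ (f w))
  shifted = toℕ-punchIn-above p (f w) (≤-trans p≤hi (≤-trans (sumUpTo-mono _ j<i) l))

-- An explicit list of Π aᵢ! distinct block bijections

length-cartesianProductWith : ∀ {A B C : Set} (f : A → B → C) xs ys →
  length (cartesianProductWith f xs ys) ≡ length xs * length ys
length-cartesianProductWith f []       ys = refl
length-cartesianProductWith f (x ∷ xs) ys = trans (length-++ (map (f x) ys))
  (cong₂ _+_ (length-map (f x) ys) (length-cartesianProductWith f xs ys))

All-cartesianProductWith : ∀ {A B C : Set} {P : A → Set} {Q : B → Set} {R : C → Set} (f : A → B → C) →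
  (∀ {x y} → P x → Q y → R (f x y)) → ∀ {xs ys} → All P xs → All Q ys → All R (cartesianProductWith f xs ys)
All-cartesianProductWith f pres []         qys = []
All-cartesianProductWith f pres (px ∷ pxs) qys =
  All.++⁺ (All.map⁺ (All.map (pres px) qys)) (All-cartesianProductWith f pres pxs qys)

windowPosition : ∀ {n} lo a → lo + a ≤ n → Fin (suc a) → Fin (suc n)
windowPosition lo a fits t = fromℕ< (s≤s (≤-trans (+-monoʳ-≤ lo (toℕ≤pred[n] t)) fits))

toℕ-windowPosition : ∀ {n} lo a (fits : lo + a ≤ n) t → toℕ (windowPosition lo a fits t) ≡ lo + toℕ t
toℕ-windowPosition lo a fits t = toℕ-fromℕ< _

window : ∀ {n} lo a → lo + a ≤ n → List (Fin (suc n))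
window lo a fits = tabulate (windowPosition lo a fits)

window-unique : ∀ {n} lo a (fits : lo + a ≤ n) → Unique (setoid (Fin (suc n))) (window lo a fits)
window-unique lo a fits = Unique.tabulate⁺ λ {t} {t′} same → toℕ-injective (+-cancelˡ-≡ lo _ _
  (trans (sym (toℕ-windowPosition lo a fits t)) (trans (cong toℕ same) (toℕ-windowPosition lo a fits t′))))

window-inside : ∀ {n} lo a (fits : lo + a ≤ n) → All (λ p → lo ≤ toℕ p × toℕ p ≤ lo + a) (window lo a fits)
window-inside lo a fits = All.tabulate⁺ λ t →
  subst (λ x → lo ≤ x × x ≤ lo + a) (sym (toℕ-windowPosition lo a fits t))
        (m≤m+n lo (toℕ t) , +-monoʳ-≤ lo (toℕ≤pred[n] t))

blockBijections : ∀ K {n} (col : Fin n → ℕ) → (∀ v → col v < K) →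
  Σ (List (Fin n → Fin n)) λ fs →
    All (BlockBijection col) fs × Unique (Fin n →-setoid Fin n) fs × length fs ≡ factProd K (classSize col)
blockBijections K {zero} col _ =
  (λ v → v) ∷ [] , (Identity.bijective _≡_ , λ ()) ∷ [] , [] ∷ [] , sym (factProd-zeroes K)
blockBijections K {suc n} col bounded with blockBijections K (col ∘ suc) (bounded ∘ suc)
... | gs , gs-blocks , gs-unique , gs-length =
  cartesianProductWith extend positions gs ,
  All-cartesianProductWith extend extend-block (window-inside lo (b j) fits) gs-blocks ,
  Uniqueₛ.cartesianProductWith⁺ (setoid (Fin (suc n))) (Fin n →-setoid Fin n) (Fin (suc n) →-setoid Fin (suc n))
    extend extend-injective (window-unique lo (b j) fits) gs-unique ,
  (begin
    length (cartesianProductWith extend positions gs)  ≡⟨ length-cartesianProductWith extend positions gs ⟩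
    length positions * length gs                       ≡⟨ cong₂ _*_ (length-tabulate (windowPosition lo (b j) fits)) gs-length ⟩
    suc (b j) * factProd K b                           ≡⟨ sym (factProd-bump-above b (bounded zero)) ⟩
    factProd K (classSize col)                         ∎)
  where
  open ≡-Reasoning
  j = col zero
  b = classSize (col ∘ suc)
  lo = sumUpTo j b
  fits : lo + b j ≤ n
  fits = ≤-trans (sumUpTo-mono b (bounded zero)) (≤-reflexive (classSize-total K (col ∘ suc) (bounded ∘ suc)))
  positions = window lo (b j) fits
  extend-block : ∀ {p g} → lo ≤ toℕ p × toℕ p ≤ lo + b j → BlockBijection (col ∘ suc) g → BlockBijection col (extend p g)
  extend-block (lo≤p , p≤hi) (bijective , inBlock) =
    extend-bijective _ _ bijective , extend-inBlock col _ _ lo≤p p≤hi inBlock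

-- On a finite domain, functions that are not pointwise equal differ at some point.
unique⇒distinguishable : ∀ {n} {fs : List (Fin n → Fin n)} → Unique (Fin n →-setoid Fin n) fs →
  AllPairs.AllPairs (λ f g → ∃ λ x → f x ≢ g x) fs
unique⇒distinguishable {n} = AllPairs.map λ {f} {g} f≉g → ¬∀⟶∃¬ n _ (λ x → f x ≟ᶠ g x) f≉g

-- The colour orientation

colourOrientation : ∀ {n} → SimpleGraph n → (Fin n → ℕ) → Fin n → Fin n → Bool
colourOrientation G col u v = adj G u v ∧ does (col u <? col v)

does-true : ∀ {P : Set} (P? : Dec P) → does P? ≡ true → P
does-true (yes p) _ = p

colourOrientation-increasing : ∀ {n} (G : SimpleGraph n) col {u v} →
  colourOrientation G col u v ≡ true → col u < col v
colourOrientation-increasing G col {u} {v} e =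
  does-true (col u <? col v) (∧-conicalʳ (adj G u v) _ e)

reach-increasing : ∀ {n} (G : SimpleGraph n) col {u v} → Reach (colourOrientation G col) u v → col u < col v
reach-increasing G col [ e ]    = colourOrientation-increasing G col e
reach-increasing G col (e ∷ r) = <-trans (colourOrientation-increasing G col e) (reach-increasing G col r)

colourOrientation-acyclic : ∀ {n} (G : SimpleGraph n) (col : Fin n → ℕ) →
  (∀ u v → adj G u v ≡ true → col u ≢ col v) → IsAcyclicOrientation G (colourOrientation G col)
colourOrientation-acyclic G col proper =
  ((λ u v e → ∧-conicalˡ (adj G u v) _ e) , covers , antisymmetric) ,
  (λ v r → <-irrefl refl (reach-increasing G col r))
  where
  covers : ∀ u v → adj G u v ≡ true →
           colourOrientation G col u v ≡ true ⊎ colourOrientation G col v u ≡ true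
  covers u v uv with <-cmp (col u) (col v)
  ... | tri< u<v _ _ = inj₁ (cong₂ _∧_ uv (dec-true (col u <? col v) u<v))
  ... | tri≈ _ u≡v _ = contradiction u≡v (proper u v uv)
  ... | tri> _ _ v<u = inj₂ (cong₂ _∧_ (trans (SimpleGraph.sym G v u) uv) (dec-true (col v <? col u) v<u))
  antisymmetric : ∀ u v → colourOrientation G col u v ≡ true → colourOrientation G col v u ≡ false
  antisymmetric u v e = trans (cong (adj G v u ∧_) (dec-false (col v <? col u) (<⇒≯ (colourOrientation-increasing G col e))))
                              (∧-zeroʳ (adj G v u))

-- A block bijection places larger colours at larger positions, so it is a linear extension.
blockBijection-linearExtension : ∀ {n} (G : SimpleGraph n) col {f} →
  BlockBijection col f → IsLinearExtension (colourOrientation G col) f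
blockBijection-linearExtension G col (bijective , inBlock) = bijective , λ u v r →
  <-≤-trans (proj₂ (inBlock u)) (≤-trans (sumUpTo-mono _ (reach-increasing G col r)) (proj₁ (inBlock v)))

-- Colourings with the minimum number of colours

-- Every colour of a minimum colouring is used: an unused colour could be punched out.
minimumColouring-surjective : ∀ {n} (G : SimpleGraph n) k (c : Fin n → Fin k) → ProperColouring G k c →
  (∀ m → Colourable G m → k ≤ m) → ∀ i → ∃ λ v → c v ≡ i
minimumColouring-surjective {n} G (suc k) c proper minimum i with any? (λ v → c v ≟ᶠ i)
... | yes used = used
... | no  unused = contradiction (minimum k (c′ , proper′)) 1+n≰n
  where
  avoids : ∀ v → i ≢ c v
  avoids v i≡cv = unused (v , sym i≡cv)
  c′ : Fin n → Fin k
  c′ v = punchOut (avoids v)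
  proper′ : ProperColouring G k c′
  proper′ u v uv same = proper u v uv (punchOut-injective (avoids u) (avoids v) same)

minimumColouring-classes : ∀ {n} (G : SimpleGraph n) k (c : Fin n → Fin k) → ProperColouring G k c →
  (∀ m → Colourable G m → k ≤ m) → AllPositive k (classSize (toℕ ∘ c))
minimumColouring-classes G k c proper minimum i i<k with minimumColouring-surjective G k c proper minimum (fromℕ< i<k)
... | v , cv≡i = subst (λ x → 1 ≤ classSize (toℕ ∘ c) x)
                       (trans (cong toℕ cv≡i) (toℕ-fromℕ< i<k)) (classSize-occupied (toℕ ∘ c) v)

corollary4p4 : ∀ (n : ℕ) (G : SimpleGraph n) (k : ℕ) → IsChromaticNumber G k →
    Σ ℕ λ L → EpsAtLeast G L × (n ! ≤ L * ((k ^ (n ∸ k)) * (k !)))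
corollary4p4 n G k ((c , proper) , minimum) with blockBijections k (toℕ ∘ c) (toℕ<n ∘ c)
... | fs , fs-blocks , fs-unique , fs-length =
  factProd k (classSize col) ,
  (colourOrientation G col ,
   colourOrientation-acyclic G col (λ u v uv → proper u v uv ∘ toℕ-injective) ,
   fs , All.map (blockBijection-linearExtension G col) fs-blocks , unique⇒distinguishable fs-unique ,
   ≤-reflexive (sym fs-length)) ,
  factorial-bound n k (classSize col) (minimumColouring-classes G k c proper minimum)
                  (classSize-total k col (toℕ<n ∘ c))
  where
  col = toℕ ∘ c
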